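{- Let $n\ge3$ be an integer. The multigraph $C_2\times C_n$ has a partition of its vertex set into 1-perfect codes if and only if $n$ is divisible by $4$. In that case the partition consists of four 1-perfect codes, and none of them is the image under the side-identification map $\pi$ of a 1-perfect code of the rectangular grid graph $\Gamma$.
   Context: $C_2$ is the multigraph with two vertices $0,1$ joined by two parallel edges, and $C_n$ is the cycle on $\mathbb{Z}_n$. $C_2\times C_n$ has vertex set $\mathbb{Z}_2\times\mathbb{Z}_n$, with $(0,j)$ and $(1,j)$ joined by two parallel edges and $(i,j)$, $(i,j\pm1)$ joined by one edge; two vertices are adjacent if joined by at least one edge. A 1-perfect code is a vertex set $S$ with no two vertices adjacent such that every vertex not in $S$ is adjacent to exactly one vertex of $S$. $\Gamma$ is the grid graph with vertex set $\{0,1,2\}\times\{0,\dots,n\}$ and edges between points at Euclidean distance $1$; $\pi(i,j)=(i\bmod 2,j\bmod n)$ identifies its opposite sides to give $C_2\times C_n$. -}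

module Defs where

open import Data.Nat using (ℕ; zero; suc; NonZero)
open import Data.Nat.DivMod using (_mod_)
open import Data.Fin using (Fin; toℕ; _≟_)
open import Data.Bool using (Bool; true; false)
open import Data.Product using (Σ; ∃; ∃!; _×_; _,_)
open import Data.Sum using (_⊎_)
open import Relation.Nullary using (¬_)
open import Relation.Nullary.Decidable using (⌊_⌋)
open import Relation.Binary.PropositionalEquality using (_≡_)
open import Function.Bundles using (_⇔_)

CycSucc : (n : ℕ) → Fin n → Fin n → Set
CycSucc n a b = (suc (toℕ a) ≡ toℕ b) ⊎ ((suc (toℕ a) ≡ n) × (toℕ b ≡ 0))

V : ℕ → Set
V n = Fin 2 × Fin n

-- Adjacency in C₂ × Cₙ ("joined by at least one edge"):
-- (0,j) ~ (1,j)  (the double edge), and (i,j) ~ (i,j±1).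
Adj : (n : ℕ) → V n → V n → Set
Adj n (i , j) (i' , j') =
  ((j ≡ j') × ¬ (i ≡ i'))
  ⊎ ((i ≡ i') × (CycSucc n j j' ⊎ CycSucc n j' j))

GV : ℕ → Set
GV n = Fin 3 × Fin (suc n)

GAdj : (n : ℕ) → GV n → GV n → Set
GAdj n (i , j) (i' , j') =
  ((toℕ i ≡ toℕ i') × ((suc (toℕ j) ≡ toℕ j') ⊎ (suc (toℕ j') ≡ toℕ j)))
  ⊎ ((toℕ j ≡ toℕ j') × ((suc (toℕ i) ≡ toℕ i') ⊎ (suc (toℕ i') ≡ toℕ i)))

IsPerfectCode : {W : Set} → (W → W → Set) → (W → Bool) → Set
IsPerfectCode {W} R S =
  (∀ u v → S u ≡ true → S v ≡ true → ¬ R u v)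
  × (∀ v → S v ≡ false → ∃! _≡_ (λ u → (S u ≡ true) × R u v))

ColourClass : {W : Set} {k : ℕ} → (W → Fin k) → Fin k → W → Bool
ColourClass c p v = ⌊ c v ≟ p ⌋

-- A partition of V(C₂ × Cₙ) into k (nonempty) 1-perfect codes,
-- given as the colouring assigning to each vertex its part.
IsPerfectCodePartition : (n k : ℕ) → (V n → Fin k) → Set
IsPerfectCodePartition n k c =
  (∀ p → ∃ λ v → c v ≡ p)
  × (∀ p → IsPerfectCode (Adj n) (ColourClass c p))

HasPerfectCodePartition : ℕ → Set
HasPerfectCodePartition n =
  Σ ℕ λ k → Σ (V n → Fin k) λ c → IsPerfectCodePartition n k c

π : (n : ℕ) .{{_ : NonZero n}} → GV n → V n
π n (i , j) = (toℕ i mod 2 , toℕ j mod n)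

IsImageUnderπ : (n : ℕ) .{{_ : NonZero n}} → (GV n → Bool) → (V n → Bool) → Set
IsImageUnderπ n T P = ∀ v → (P v ≡ true) ⇔ (∃ λ w → (T w ≡ true) × (π n w ≡ v))

module Submission where

-- Write [ m ] for the residue of m modulo n.  Every 1-perfect code S of
-- C₂ × Cₙ is rigid: it never meets two consecutive columns, and the unique
-- S-neighbour of the free vertex (swap i , [1+m]) must be (swap i , [2+m])
-- whenever (i , [m]) ∈ S ("zigzag").  Three consequences are drawn:
--   * S meets the 2 × 2 block formed by columns 1 and 2 in exactly one vertex,
--     so the colours of a partition into perfect codes are in bijection with
--     the four block vertices, whence there are four parts;
--   * iterating the zigzag from (0 , [0]) along n = r + 4t rules out r ≠ 0,
--     so a partition forces 4 ∣ n;
--   * a perfect code T of the grid Γ with π(T) ⊆ S would identify [m] and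
--     [2+m] (m ∈ {0,1}) through a column of Γ over a column missed by S.
-- Conversely, if 4 ∣ n the colouring (i , j) ↦ j + 2i (mod 4), realised as a
-- rotation of Fin 4, shows each colour exactly once on every closed
-- neighbourhood, and such colourings always split into perfect codes.

open import Defs
open import Data.Nat using (ℕ; NonZero; zero; suc; _+_; _*_; _%_; _/_; _≤_; _<_; z≤n; s≤s)
open import Data.Nat.Properties using (suc-injective; <-irrefl; <⇒≤; +-suc; +-comm; +-identityʳ; m≤n⇒m<n∨m≡n)
open import Data.Nat.Divisibility using (_∣_; divides)
open import Data.Nat.DivMod using (_mod_; m≡m%n+[m/n]*n; [m+n]%n≡m%n; [m+kn]%n≡m%n; m<n⇒m%n≡m; n%n≡0; m%n<n; m∣n⇒o%n%m≡o%m)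
open import Data.Fin using (Fin; toℕ; fromℕ<; _≟_)
open import Data.Fin.Patterns using (0F; 1F; 2F; 3F)
open import Data.Fin.Properties using (toℕ-injective; toℕ<n; toℕ-fromℕ<; *↔×; all?; any?)
open import Data.Fin.Permutation using (↔⇒≡)
open import Data.Bool using (Bool; true; false)
open import Data.Product using (Σ; ∃; ∃!; _×_; _,_; proj₁; proj₂)
open import Data.Sum using (_⊎_; inj₁; inj₂)
open import Data.Empty using (⊥; ⊥-elim)
open import Relation.Nullary using (¬_; yes; no)
open import Relation.Nullary.Decidable using (toWitness; _→-dec_)
open import Relation.Binary.PropositionalEquality using (_≡_; refl; sym; trans; cong; subst; module ≡-Reasoning)
open import Function.Bundles using (_⇔_; _↔_; mk⇔; mk↔ₛ′; Equivalence)
open import Function.Construct.Composition using (_↔-∘_)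
open import Function.Construct.Symmetry using (↔-sym)

clash : ∀ {b : Bool} → b ≡ true → b ≡ false → ⊥
clash refl ()

swap : Fin 2 → Fin 2
swap 0F = 1F
swap 1F = 0F

swap-≢ : ∀ i → ¬ swap i ≡ i
swap-≢ 0F ()
swap-≢ 1F ()

swap-involutive : ∀ i → swap (swap i) ≡ i
swap-involutive 0F = refl
swap-involutive 1F = refl

≢⇒swap : ∀ {i i' : Fin 2} → ¬ i ≡ i' → i ≡ swap i'
≢⇒swap {0F} {0F} ne = ⊥-elim (ne refl)
≢⇒swap {0F} {1F} _  = refl
≢⇒swap {1F} {0F} _  = refl
≢⇒swap {1F} {1F} ne = ⊥-elim (ne refl)

∈-class : ∀ {W : Set} {k} (c : W → Fin k) {p v} → c v ≡ p → ColourClass c p v ≡ true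
∈-class c {p} {v} e with c v ≟ p
... | yes _ = refl
... | no ne = ⊥-elim (ne e)

class⇒colour : ∀ {W : Set} {k} (c : W → Fin k) {p v} → ColourClass c p v ≡ true → c v ≡ p
class⇒colour c {p} {v} e with c v ≟ p
... | yes cv≡p = cv≡p

∉-class : ∀ {W : Set} {k} (c : W → Fin k) {p v} → ColourClass c p v ≡ false → ¬ c v ≡ p
∉-class c v∉ cv≡p = clash (∈-class c cv≡p) v∉

classes-perfect : {W : Set} {k : ℕ} (R : W → W → Set) (c : W → Fin k) →
  (∀ u v → R u v → ¬ c u ≡ c v) →
  (∀ v p → ¬ c v ≡ p → ∃! _≡_ (λ u → (c u ≡ p) × R u v)) →
  ∀ p → IsPerfectCode R (ColourClass c p)
classes-perfect R c proper rainbow p = independent , dominated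
  where
  independent : ∀ u v → ColourClass c p u ≡ true → ColourClass c p v ≡ true → ¬ R u v
  independent u v u∈ v∈ uv = proper u v uv (trans (class⇒colour c u∈) (sym (class⇒colour c v∈)))

  dominated : ∀ v → ColourClass c p v ≡ false → ∃! _≡_ (λ u → (ColourClass c p u ≡ true) × R u v)
  dominated v v∉ with rainbow v p (∉-class c v∉)
  ... | u , (cu , uv) , unique =
    u , (∈-class c cu , uv) , λ (u'∈ , u'v) → unique (class⇒colour c u'∈ , u'v)

CycSucc-functional : ∀ {n} {a b b' : Fin n} → CycSucc n a b → CycSucc n a b' → b ≡ b'
CycSucc-functional (inj₁ p) (inj₁ q) = toℕ-injective (trans (sym p) q)
CycSucc-functional {b = b} (inj₁ p) (inj₂ (q , _)) = ⊥-elim (<-irrefl (trans (sym p) q) (toℕ<n b))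
CycSucc-functional {b' = b'} (inj₂ (p , _)) (inj₁ q) = ⊥-elim (<-irrefl (trans (sym q) p) (toℕ<n b'))
CycSucc-functional (inj₂ (_ , p)) (inj₂ (_ , q)) = toℕ-injective (trans p (sym q))

CycSucc-injective : ∀ {n} {a a' b : Fin n} → CycSucc n a b → CycSucc n a' b → a ≡ a'
CycSucc-injective (inj₁ p) (inj₁ q) = toℕ-injective (suc-injective (trans p (sym q)))
CycSucc-injective (inj₁ p) (inj₂ (_ , q)) with trans p q
... | ()
CycSucc-injective (inj₂ (_ , p)) (inj₁ q) with trans q p
... | ()
CycSucc-injective (inj₂ (p , _)) (inj₂ (q , _)) = toℕ-injective (suc-injective (trans p (sym q)))

GAdj-cases : ∀ {n} {r r' : Fin 3} {j j' : Fin (suc n)} → GAdj n (r , j) (r' , j') →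
  (toℕ j ≡ toℕ j') ⊎ ((r ≡ r') × ((suc (toℕ j) ≡ toℕ j') ⊎ (suc (toℕ j') ≡ toℕ j)))
GAdj-cases (inj₁ (same-row , horizontal)) = inj₂ (toℕ-injective same-row , horizontal)
GAdj-cases (inj₂ (same-column , _)) = inj₁ same-column

rot : Fin 4 → Fin 4
rot 0F = 1F
rot 1F = 2F
rot 2F = 3F
rot 3F = 0F

rot^ : ℕ → Fin 4 → Fin 4
rot^ zero x = x
rot^ (suc a) x = rot (rot^ a x)

rot^-+ : ∀ a b x → rot^ (a + b) x ≡ rot^ a (rot^ b x)
rot^-+ zero b x = refl
rot^-+ (suc a) b x = cong rot (rot^-+ a b x)

rot^-comm : ∀ a b x → rot^ a (rot^ b x) ≡ rot^ b (rot^ a x)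
rot^-comm a b x = begin
  rot^ a (rot^ b x)  ≡⟨ rot^-+ a b x ⟨
  rot^ (a + b) x     ≡⟨ cong (λ s → rot^ s x) (+-comm a b) ⟩
  rot^ (b + a) x     ≡⟨ rot^-+ b a x ⟩
  rot^ b (rot^ a x)  ∎
  where open ≡-Reasoning

rot^-*4 : ∀ t x → rot^ (t * 4) x ≡ x
rot^-*4 zero x = refl
rot^-*4 (suc t) x = trans (order-4 (rot^ (t * 4) x)) (rot^-*4 t x)
  where
  order-4 : ∀ y → rot^ 4 y ≡ y
  order-4 0F = refl
  order-4 1F = refl
  order-4 2F = refl
  order-4 3F = refl

rot^-mod4 : ∀ a x → rot^ a x ≡ rot^ (a % 4) x
rot^-mod4 a x = begin
  rot^ a x                               ≡⟨ cong (λ s → rot^ s x) (m≡m%n+[m/n]*n a 4) ⟩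
  rot^ (a % 4 + (a / 4) * 4) x           ≡⟨ rot^-+ (a % 4) ((a / 4) * 4) x ⟩
  rot^ (a % 4) (rot^ ((a / 4) * 4) x)    ≡⟨ cong (rot^ (a % 4)) (rot^-*4 (a / 4) x) ⟩
  rot^ (a % 4) x                         ∎
  where open ≡-Reasoning

rot^-injective : ∀ y (d d' : Fin 4) → rot^ (toℕ d) y ≡ rot^ (toℕ d') y → d ≡ d'
rot^-injective = toWitness {a? = all? λ y → all? λ d → all? λ d' →
                                   (rot^ (toℕ d) y ≟ rot^ (toℕ d') y) →-dec (d ≟ d')} _

rot^-surjective : ∀ y p → ∃ λ (d : Fin 4) → rot^ (toℕ d) y ≡ p
rot^-surjective = toWitness {a? = all? λ y → all? λ p → any? λ d → rot^ (toℕ d) y ≟ p} _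

base : Fin 2 → Fin 4
base 0F = 0F
base 1F = 2F

base-swap : ∀ i → base (swap i) ≡ rot^ 2 (base i)
base-swap 0F = refl
base-swap 1F = refl

module Cycle (n₀ : ℕ) where

  n : ℕ
  n = suc n₀

  [_] : ℕ → Fin n
  [ m ] = m mod n

  toℕ-[] : ∀ m → toℕ [ m ] ≡ m % n
  toℕ-[] m = toℕ-fromℕ< _

  []-cong : ∀ {m m'} → m % n ≡ m' % n → [ m ] ≡ [ m' ]
  []-cong {m} {m'} e = toℕ-injective (trans (toℕ-[] m) (trans e (sym (toℕ-[] m'))))

  [n] : [ n ] ≡ [ 0 ]
  [n] = []-cong {n} {0} ([m+n]%n≡m%n 0 n)

  -- Every residue is a successor residue, so it suffices to treat vertices (i , [1+m]).
  every-residue : ∀ j → [ suc (toℕ j + n₀) ] ≡ j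
  every-residue j = begin
    [ suc (toℕ j + n₀) ]  ≡⟨ cong [_] (+-suc (toℕ j) n₀) ⟨
    [ toℕ j + n ]         ≡⟨ []-cong {toℕ j + n} {toℕ j} ([m+n]%n≡m%n (toℕ j) n) ⟩
    [ toℕ j ]             ≡⟨ toℕ-injective (trans (toℕ-[] (toℕ j)) (m<n⇒m%n≡m (toℕ<n j))) ⟩
    j                     ∎
    where open ≡-Reasoning

  cover : (Q : V n → Set) → (∀ i m → Q (i , [ suc m ])) → ∀ v → Q v
  cover Q q (i , j) = subst (λ j' → Q (i , j')) (every-residue j) (q i (toℕ j + n₀))

  toℕ-[suc] : ∀ m → toℕ [ suc m ] ≡ suc (toℕ [ m ]) % n
  toℕ-[suc] m = begin
    toℕ [ suc m ]                 ≡⟨ toℕ-[] (suc m) ⟩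
    suc m % n                     ≡⟨ cong (λ x → suc x % n) (m≡m%n+[m/n]*n m n) ⟩
    (suc (m % n) + m / n * n) % n ≡⟨ [m+kn]%n≡m%n (suc (m % n)) (m / n) n ⟩
    suc (m % n) % n               ≡⟨ cong (λ x → suc x % n) (toℕ-[] m) ⟨
    suc (toℕ [ m ]) % n           ∎
    where open ≡-Reasoning

  cycSucc : ∀ m → CycSucc n [ m ] [ suc m ]
  cycSucc m with m≤n⇒m<n∨m≡n (toℕ<n [ m ])
  ... | inj₁ below = inj₁ (sym (trans (toℕ-[suc] m) (m<n⇒m%n≡m below)))
  ... | inj₂ last = inj₂ (last , trans (toℕ-[suc] m) (trans (cong (_% n) last) (n%n≡0 n)))

  [m]≢[2+m] : 3 ≤ n → ∀ m → ¬ [ m ] ≡ [ suc (suc m) ]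
  [m]≢[2+m] 3≤n zero e with trans (cong toℕ e) (trans (toℕ-[] 2) (m<n⇒m%n≡m 3≤n))
  ... | ()
  [m]≢[2+m] 3≤n (suc m) e = [m]≢[2+m] 3≤n m
    (CycSucc-injective (cycSucc m) (subst (CycSucc n [ suc (suc m) ]) (sym e) (cycSucc (suc (suc m)))))

  across : ∀ {i i' j} → ¬ i ≡ i' → Adj n (i , j) (i' , j)
  across i≢i' = inj₁ (refl , i≢i')

  forward : ∀ {i} m → Adj n (i , [ m ]) (i , [ suc m ])
  forward m = inj₂ (refl , inj₁ (cycSucc m))

  backward : ∀ {i} m → Adj n (i , [ suc m ]) (i , [ m ])
  backward m = inj₂ (refl , inj₂ (cycSucc m))

  ball : Fin 2 → ℕ → Fin 4 → V n
  ball i m 0F = (i , [ m ])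
  ball i m 1F = (i , [ suc m ])
  ball i m 2F = (i , [ suc (suc m) ])
  ball i m 3F = (swap i , [ suc m ])

  ball-adjacent : ∀ i m d → ¬ d ≡ 1F → Adj n (ball i m d) (i , [ suc m ])
  ball-adjacent i m 0F _ = forward m
  ball-adjacent i m 1F d≢1 = ⊥-elim (d≢1 refl)
  ball-adjacent i m 2F _ = backward (suc m)
  ball-adjacent i m 3F _ = across (swap-≢ i)

  adjacent-ball : ∀ {u} i m → Adj n u (i , [ suc m ]) → ∃ λ d → (¬ d ≡ 1F) × (u ≡ ball i m d)
  adjacent-ball i m (inj₁ (refl , i'≢i)) = 3F , (λ ()) , cong (_, [ suc m ]) (≢⇒swap i'≢i)
  adjacent-ball i m (inj₂ (refl , inj₁ succ)) = 0F , (λ ()) , cong (i ,_) (CycSucc-injective succ (cycSucc m))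
  adjacent-ball i m (inj₂ (refl , inj₂ succ)) = 2F , (λ ()) , cong (i ,_) (CycSucc-functional succ (cycSucc (suc m)))

  block : Fin 2 × Fin 2 → V n
  block (i , d) = (i , [ suc (toℕ d) ])

  module PerfectCode (S : V n → Bool) (code : IsPerfectCode (Adj n) S) where

    independent : ∀ {u v} → S u ≡ true → S v ≡ true → ¬ Adj n u v
    independent su sv = proj₁ code _ _ su sv

    unique-dominator : ∀ {u u' w} → S w ≡ false → S u ≡ true → S u' ≡ true →
                       Adj n u w → Adj n u' w → u ≡ u'
    unique-dominator {w = w} sw su su' uw u'w with proj₂ code w sw
    ... | _ , _ , unique = trans (sym (unique (su , uw))) (unique (su' , u'w))

    no-common-neighbour : ∀ {u u' w} → S u ≡ true → S u' ≡ true →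
                          Adj n u w → Adj n u' w → ¬ u ≡ u' → ⊥
    no-common-neighbour {w = w} su su' uw u'w u≢u' with S w in sw
    ... | true = independent su sw uw
    ... | false = u≢u' (unique-dominator sw su su' uw u'w)

    same-column : ∀ {i i' j} → S (i , j) ≡ true → S (i' , j) ≡ true → i ≡ i'
    same-column {i} {i'} s s' with i ≟ i'
    ... | yes i≡i' = i≡i'
    ... | no i≢i' = ⊥-elim (independent s s' (across i≢i'))

    consecutive-columns : ∀ m {a b} → S (a , [ m ]) ≡ true → S (b , [ suc m ]) ≡ true → ⊥
    consecutive-columns m {a} {b} sa sb with a ≟ b
    ... | yes refl = independent sa sb (forward m)
    ... | no a≢b = no-common-neighbour sa sb (forward m) (across (λ e → a≢b (sym e)))
                                       (λ e → a≢b (cong proj₁ e))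

    dominator : ∀ i m → S (i , [ suc m ]) ≡ false → ∃ λ d → (¬ d ≡ 1F) × (S (ball i m d) ≡ true)
    dominator i m free with proj₂ code (i , [ suc m ]) free
    ... | u , (su , uv) , _ with adjacent-ball i m uv
    ... | d , d≢1 , refl = d , d≢1 , su

    zigzag : ∀ {i} m → S (i , [ m ]) ≡ true → S (swap i , [ suc (suc m) ]) ≡ true
    zigzag {i} m s with S (swap i , [ suc m ]) in free
    ... | true = ⊥-elim (consecutive-columns m s free)
    ... | false with dominator (swap i) m free
    ... | 0F , _ , s' = ⊥-elim (independent s' s (across (swap-≢ i)))
    ... | 1F , d≢1 , _ = ⊥-elim (d≢1 refl)
    ... | 2F , _ , s' = s'
    ... | 3F , _ , s' = ⊥-elim (consecutive-columns m s s')

    zigzag⁴ : ∀ t {i m} → S (i , [ m ]) ≡ true → S (i , [ t * 4 + m ]) ≡ true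
    zigzag⁴ zero s = s
    zigzag⁴ (suc t) {i} s =
      subst (λ r → S (r , _) ≡ true) (swap-involutive i) (zigzag _ (zigzag _ (zigzag⁴ t s)))

    left-of-empty-block : ∀ i → S (i , [ 1 ]) ≡ false → S (swap i , [ 1 ]) ≡ false →
                          S (i , [ 2 ]) ≡ false → S (i , [ 0 ]) ≡ true
    left-of-empty-block i free free-across free-right with dominator i 0 free
    ... | 0F , _ , s = s
    ... | 1F , d≢1 , _ = ⊥-elim (d≢1 refl)
    ... | 2F , _ , s = ⊥-elim (clash s free-right)
    ... | 3F , _ , s = ⊥-elim (clash s free-across)

    block-meets : ∃ λ b → S (block b) ≡ true
    block-meets with S (block (0F , 0F)) in e₀₀ | S (block (1F , 0F)) in e₁₀
                   | S (block (0F , 1F)) in e₀₁ | S (block (1F , 1F)) in e₁₁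
    ... | true  | _     | _     | _    = _ , e₀₀
    ... | false | true  | _     | _    = _ , e₁₀
    ... | false | false | true  | _    = _ , e₀₁
    ... | false | false | false | true = _ , e₁₁
    ... | false | false | false | false =
      ⊥-elim (independent (left-of-empty-block 0F e₀₀ e₁₀ e₀₁) (left-of-empty-block 1F e₁₀ e₀₀ e₁₁)
                          (across (λ ())))

    block-unique : ∀ b b' → S (block b) ≡ true → S (block b') ≡ true → b ≡ b'
    block-unique (i , 0F) (i' , 0F) s s' = cong (_, 0F) (same-column s s')
    block-unique (i , 1F) (i' , 1F) s s' = cong (_, 1F) (same-column s s')
    block-unique (i , 0F) (i' , 1F) s s' = ⊥-elim (consecutive-columns 1 s s')
    block-unique (i , 1F) (i' , 0F) s s' = ⊥-elim (consecutive-columns 1 s' s)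

    -- A code through (0 , [0]) exists only if 4 ∣ n: write n = r + 4t, r < 4, and
    -- compare the zigzag images of (0 , [0]) near column 4t with column n = 0.
    four-divides : S (0F , [ 0 ]) ≡ true → 4 ∣ n
    four-divides s₀ = divides (n / 4) (residue-vanishes (n % 4) (n / 4) (m%n<n n 4) (m≡m%n+[m/n]*n n 4))
      where
      wraps : ∀ {m} → n ≡ m → [ m ] ≡ [ 0 ]
      wraps refl = [n]

      at-4t : ∀ t → S (0F , [ t * 4 ]) ≡ true
      at-4t t = subst (λ m → S (0F , [ m ]) ≡ true) (+-identityʳ (t * 4)) (zigzag⁴ t s₀)

      residue-vanishes : ∀ r t → r < 4 → n ≡ r + t * 4 → n ≡ t * 4
      residue-vanishes 0 _ _ e = e
      residue-vanishes 1 t _ e = ⊥-elim (consecutive-columns (t * 4) (at-4t t)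
        (subst (λ j → S (0F , j) ≡ true) (sym (wraps e)) s₀))
      residue-vanishes 2 t _ e = ⊥-elim (independent s₀
        (subst (λ j → S (1F , j) ≡ true) (wraps e) (zigzag (t * 4) (at-4t t))) (across (λ ())))
      residue-vanishes 3 t _ e = ⊥-elim (consecutive-columns (2 + t * 4) (zigzag (t * 4) (at-4t t))
        (subst (λ j → S (0F , j) ≡ true) (sym (wraps e)) s₀))
      residue-vanishes (suc (suc (suc (suc r)))) _ (s≤s (s≤s (s≤s (s≤s ())))) _

  -- A partition into 1-perfect codes has exactly four parts: each colour meets
  -- the block exactly once, so colours correspond to block vertices.
  partition-size : ∀ {k} (c : V n → Fin k) → (∀ p → IsPerfectCode (Adj n) (ColourClass c p)) → k ≡ 4
  partition-size {k} c codes = ↔⇒≡ (↔-sym *↔× ↔-∘ colours↔block)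
    where
    meet : Fin k → Fin 2 × Fin 2
    meet p = proj₁ (PerfectCode.block-meets (ColourClass c p) (codes p))

    colour-meet : ∀ p → c (block (meet p)) ≡ p
    colour-meet p = class⇒colour c (proj₂ (PerfectCode.block-meets (ColourClass c p) (codes p)))

    meet-colour : ∀ b → meet (c (block b)) ≡ b
    meet-colour b = PerfectCode.block-unique (ColourClass c p) (codes p) (meet p) b
                      (proj₂ (PerfectCode.block-meets (ColourClass c p) (codes p))) (∈-class c refl)
      where p = c (block b)

    colours↔block : Fin k ↔ (Fin 2 × Fin 2)
    colours↔block = mk↔ₛ′ meet (λ b → c (block b)) meet-colour colour-meet

  partition⇒4∣n : HasPerfectCodePartition n → 4 ∣ n
  partition⇒4∣n (k , c , _ , codes) =
    PerfectCode.four-divides (ColourClass c (c (0F , [ 0 ]))) (codes _) (∈-class c refl)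

  colouring : V n → Fin 4
  colouring (i , j) = rot^ (toℕ j) (base i)

  module Rotation (4∣n : 4 ∣ n) where

    colouring-[] : ∀ i m → colouring (i , [ m ]) ≡ rot^ m (base i)
    colouring-[] i m = begin
      rot^ (toℕ [ m ]) (base i)    ≡⟨ cong (λ s → rot^ s (base i)) (toℕ-[] m) ⟩
      rot^ (m % n) (base i)        ≡⟨ rot^-mod4 (m % n) (base i) ⟩
      rot^ (m % n % 4) (base i)    ≡⟨ cong (λ s → rot^ s (base i)) (m∣n⇒o%n%m≡o%m 4 n m 4∣n) ⟩
      rot^ (m % 4) (base i)        ≡⟨ rot^-mod4 m (base i) ⟨
      rot^ m (base i)              ∎
      where open ≡-Reasoning

    colouring-ball : ∀ i m d → colouring (ball i m d) ≡ rot^ (toℕ d) (rot^ m (base i))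
    colouring-ball i m 0F = colouring-[] i m
    colouring-ball i m 1F = colouring-[] i (suc m)
    colouring-ball i m 2F = colouring-[] i (suc (suc m))
    colouring-ball i m 3F = trans (colouring-[] (swap i) (suc m))
      (cong rot (trans (cong (rot^ m) (base-swap i)) (rot^-comm m 2 (base i))))

    proper : ∀ u v → Adj n u v → ¬ colouring u ≡ colouring v
    proper u = cover _ λ i m uv same → proper-at i m uv same
      where
      proper-at : ∀ {u} i m → Adj n u (i , [ suc m ]) → ¬ colouring u ≡ colouring (i , [ suc m ])
      proper-at i m uv same with adjacent-ball i m uv
      ... | d , d≢1 , refl = d≢1 (rot^-injective _ d 1F
        (trans (sym (colouring-ball i m d)) (trans same (colouring-ball i m 1F))))

    rainbow : ∀ v p → ¬ colouring v ≡ p → ∃! _≡_ (λ u → (colouring u ≡ p) × Adj n u v)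
    rainbow = cover _ rainbow-at
      where
      rainbow-at : ∀ i m p → ¬ colouring (i , [ suc m ]) ≡ p →
                   ∃! _≡_ (λ u → (colouring u ≡ p) × Adj n u (i , [ suc m ]))
      rainbow-at i m p p≢centre with rot^-surjective (rot^ m (base i)) p
      ... | d , d↦p = ball i m d , (trans (colouring-ball i m d) d↦p , ball-adjacent i m d d≢1) , unique
        where
        d≢1 : ¬ d ≡ 1F
        d≢1 refl = p≢centre (trans (colouring-ball i m 1F) d↦p)

        unique : ∀ {u} → (colouring u ≡ p) × Adj n u (i , [ suc m ]) → ball i m d ≡ u
        unique (cu , uv) with adjacent-ball i m uv
        ... | d' , _ , refl = cong (ball i m) (rot^-injective _ d d'
          (trans d↦p (sym (trans (sym (colouring-ball i m d')) cu))))

    every-colour-used : ∀ p → ∃ λ v → colouring v ≡ p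
    every-colour-used p with rot^-surjective 0F p
    ... | d , d↦p = (0F , [ toℕ d ]) , trans (colouring-[] 0F (toℕ d)) d↦p

    partition : IsPerfectCodePartition n 4 colouring
    partition = every-colour-used , classes-perfect (Adj n) colouring proper rainbow

  module NoLift (P : V n → Bool) (codeP : IsPerfectCode (Adj n) P)
                (T : GV n → Bool) (codeT : IsPerfectCode (GAdj n) T)
                (T↦P : ∀ w → T w ≡ true → P (π n w) ≡ true) where
    open PerfectCode P codeP

    image : ∀ {r j c} → T (r , j) ≡ true → toℕ j ≡ c → P (toℕ r mod 2 , [ c ]) ≡ true
    image {r} {j} t refl = T↦P (r , j) t

    -- Rows 0 and 2 of Γ never both meet T in one column: the middle vertex
    -- would be in T (clashing with P) or doubly dominated.
    outer-rows : ∀ {j₀ j₂} → T (0F , j₀) ≡ true → T (2F , j₂) ≡ true → ¬ toℕ j₀ ≡ toℕ j₂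
    outer-rows {j₀} t₀ t₂ aligned with toℕ-injective aligned
    ... | refl with T (1F , j₀) in t₁
    ... | true = independent (image t₀ refl) (image t₁ refl) (across (λ ()))
    ... | false with proj₂ codeT (1F , j₀) t₁
    ... | _ , _ , unique with trans (sym (unique (t₀ , inj₂ (refl , inj₁ refl))))
                                    (unique (t₂ , inj₂ (refl , inj₂ refl)))
    ... | ()

    pinch : ∀ m → P (0F , [ suc m ]) ≡ false → P (0F , [ m ]) ≡ true →
            P (0F , [ suc (suc m) ]) ≡ true → [ m ] ≡ [ suc (suc m) ]
    pinch m free left right = cong proj₂ (unique-dominator free left right (forward m) (backward (suc m)))

    -- A column [1+m] missed by P, lying under the grid column j, forces [m] ≡ [2+m]:
    -- T avoids the whole grid column, so rows 0 and 2 there are dominated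
    -- horizontally, necessarily from different sides.
    module Gap (m : ℕ) (j : Fin (suc n)) (j≡ : toℕ j ≡ suc m)
               (empty : ∀ i → P (i , [ suc m ]) ≡ false) where

      off-column : ∀ {r j'} → T (r , j') ≡ true → ¬ toℕ j' ≡ suc m
      off-column t e = clash (image t e) (empty _)

      T-off : ∀ r → T (r , j) ≡ false
      T-off r with T (r , j) in t
      ... | true = ⊥-elim (off-column t j≡)
      ... | false = refl

      flank : ∀ r → ∃ λ j' → (T (r , j') ≡ true) × ((toℕ j' ≡ m) ⊎ (toℕ j' ≡ suc (suc m)))
      flank r with proj₂ codeT (r , j) (T-off r)
      ... | (_ , j') , (t , adj) , _ with GAdj-cases adj
      ... | inj₁ same = ⊥-elim (off-column t (trans same j≡))
      ... | inj₂ (refl , inj₁ left) = j' , t , inj₁ (suc-injective (trans left j≡))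
      ... | inj₂ (refl , inj₂ right) = j' , t , inj₂ (trans (sym right) (cong suc j≡))

      collapse : [ m ] ≡ [ suc (suc m) ]
      collapse with flank 0F | flank 2F
      ... | _ , t₀ , inj₁ e₀ | _ , t₂ , inj₁ e₂ = ⊥-elim (outer-rows t₀ t₂ (trans e₀ (sym e₂)))
      ... | _ , t₀ , inj₂ e₀ | _ , t₂ , inj₂ e₂ = ⊥-elim (outer-rows t₀ t₂ (trans e₀ (sym e₂)))
      ... | _ , t₀ , inj₁ e₀ | _ , t₂ , inj₂ e₂ = pinch m (empty 0F) (image t₀ e₀) (image t₂ e₂)
      ... | _ , t₀ , inj₂ e₀ | _ , t₂ , inj₁ e₂ = pinch m (empty 0F) (image t₂ e₂) (image t₀ e₀)

    occupancy : ∀ c → (∀ i → P (i , [ c ]) ≡ false) ⊎ (∃ λ i → P (i , [ c ]) ≡ true)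
    occupancy c with P (0F , [ c ]) in e₀ | P (1F , [ c ]) in e₁
    ... | true  | _     = inj₂ (0F , e₀)
    ... | false | true  = inj₂ (1F , e₁)
    ... | false | false = inj₁ λ { 0F → e₀ ; 1F → e₁ }

    gap : ∀ m → suc m < suc n → (∀ i → P (i , [ suc m ]) ≡ false) → [ m ] ≡ [ suc (suc m) ]
    gap m below = Gap.collapse m (fromℕ< below) (toℕ-fromℕ< below)

    -- Columns 1 and 2 cannot both meet P, and a free one contradicts n ≥ 3.
    impossible : 3 ≤ n → ⊥
    impossible 3≤n with occupancy 1 | occupancy 2
    ... | inj₂ (_ , p₁) | inj₂ (_ , p₂) = consecutive-columns 1 p₁ p₂
    ... | inj₁ empty₁ | _ = [m]≢[2+m] 3≤n 0 (gap 0 (s≤s (s≤s z≤n)) empty₁)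
    ... | inj₂ _ | inj₁ empty₂ = [m]≢[2+m] 3≤n 1 (gap 1 (s≤s (<⇒≤ 3≤n)) empty₂)

theorem12 : (n : ℕ) .{{_ : NonZero n}} → 3 ≤ n →
    (HasPerfectCodePartition n ⇔ (4 ∣ n))
    × (∀ (k : ℕ) (c : V n → Fin k) → IsPerfectCodePartition n k c →
        (k ≡ 4)
        × (∀ (p : Fin k) → ¬ (Σ (GV n → Bool) λ T →
             IsPerfectCode (GAdj n) T × IsImageUnderπ n T (ColourClass c p))))
theorem12 (suc n₀) 3≤n =
  mk⇔ partition⇒4∣n (λ 4∣n → 4 , colouring , Rotation.partition 4∣n) ,
  λ k c (_ , codes) → partition-size c codes ,
    λ p (T , codeT , image) → NoLift.impossible (ColourClass c p) (codes p) T codeT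
      (λ w t → Equivalence.from (image (π (suc n₀) w)) (w , t , refl)) 3≤n
  where open Cycle n₀
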